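{- Suppose the cyclic group $C_n=\langle\sigma_n\rangle$ of order $n$ acts on a finite set $W$. Let $g\mid n$ and let $C_g=\langle\sigma_n^{n/g}\rangle\subseteq C_n$. Let $f(q)\in\mathbb{N}[q]$. If (i) $(W,C_g,f(q))$ exhibits the CSP, (ii) $f(q)$ has period $g$ modulo $n$, and (iii) for every $C_n$-orbit $\mathcal{O}\subseteq W$ we have $\frac{n}{|\mathcal{O}|}\mid g$, then $(W,C_n,f(q))$ exhibits the CSP.
   Context: For a finite set $W$ with an action of a cyclic group $C=\langle\tau\rangle$ of order $r$ and $f(q)\in\mathbb{N}[q]$, the triple $(W,C,f(q))$ exhibits the cyclic sieving phenomenon (CSP) if for all $j\in\mathbb{Z}$, $\#\{x\in W:\tau^j\cdot x=x\}=f(\omega_r^j)$, where $\omega_r$ is a fixed primitive $r$-th root of unity. A polynomial $f(q)$ has period $a$ modulo $b$ if $q^af(q)\equiv f(q)\pmod{q^b-1}$. -}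

module Defs where

open import Level using (Level; _⊔_)
open import Algebra.Bundles using (CommutativeRing; Semiring)
open import Data.Nat using (ℕ; zero; suc; _∸_; _<_; _≤?_)
open import Data.Nat.Divisibility using (_∣_)
open import Data.Fin using (Fin)
open import Data.Fin.Properties using (_≟_)
open import Data.List using (List; []; _∷_; length; filter)
open import Data.List.Base using (allFin)
open import Data.List.Relation.Unary.Any using (any?)
open import Data.Integer as ℤ using (ℤ)
open import Data.Product using (Σ; _×_)
import Data.Sum
import Data.Fin
open import Relation.Binary.PropositionalEquality using (_≡_)
open import Relation.Nullary using (¬_; yes; no)

-- Cyclic actions on a finite set W = Fin m.
-- An action of C_r = ⟨τ⟩ (order r) on Fin m is given by the action
-- of the generator τ : Fin m → Fin m with τ^r = id.

iter : {A : Set} → (A → A) → ℕ → A → A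
iter f zero    x = x
iter f (suc k) x = f (iter f k x)

IsCyclicAction : (m r : ℕ) → (Fin m → Fin m) → Set
IsCyclicAction m r τ = ∀ x → iter τ r x ≡ x

fixCount : {m : ℕ} → (Fin m → Fin m) → ℕ → ℕ
fixCount {m} τ j = length (filter (λ x → iter τ j x ≟ x) (allFin m))

orbitSize : {m : ℕ} → (n : ℕ) → (Fin m → Fin m) → Fin m → ℕ
orbitSize {m} n σ x =
  length (filter (λ y → any? (λ (k : Fin n) → iter σ (Data.Fin.toℕ k) x ≟ y) (allFin n)) (allFin m))

-- Polynomials in ℕ[q] / ℤ[q] as coefficient lists (constant term first).

coeff : {A : Set} → A → List A → ℕ → A
coeff z []       k       = z
coeff z (a ∷ as) zero    = a
coeff z (a ∷ as) (suc k) = coeff z as k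

shiftCoeff : ℕ → List ℤ → ℕ → ℤ
shiftCoeff s p k with s Data.Nat.≤? k
... | yes _ = coeff (ℤ.+ 0) p (k ∸ s)
... | no  _ = ℤ.+ 0

toℤPoly : List ℕ → List ℤ
toℤPoly [] = []
toℤPoly (a ∷ as) = ℤ.+ a ∷ toℤPoly as

-- f(q) has period a modulo b :  q^a f(q) ≡ f(q)  (mod q^b − 1)  in ℤ[q],
-- i.e. there is h ∈ ℤ[q] with q^a f(q) − f(q) = (q^b − 1) h(q).
HasPeriod : List ℕ → ℕ → ℕ → Set
HasPeriod f a b = Σ (List ℤ) λ h → ∀ k →
  shiftCoeff a (toℤPoly f) k ℤ.- coeff (ℤ.+ 0) (toℤPoly f) k
    ≡ shiftCoeff b h k ℤ.- coeff (ℤ.+ 0) h k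

-- Ring-side notions. The paper evaluates at roots of unity in ℂ; we work
-- in an arbitrary commutative ring that is an integral domain of
-- characteristic 0 (ℂ being one instance).

module _ {c ℓ : Level} (R : CommutativeRing c ℓ) where
  open CommutativeRing R
  open import Algebra.Definitions.RawSemiring (Semiring.rawSemiring (CommutativeRing.semiring R)) using (_^_) renaming (_×_ to _·_)

  IsChar0Domain : Set (c ⊔ ℓ)
  IsChar0Domain =
    (¬ (1# ≈ 0#)) ×
    (∀ x y → x * y ≈ 0# → (x ≈ 0#) Data.Sum.⊎ (y ≈ 0#)) ×
    (∀ a b → (a · 1#) ≈ (b · 1#) → a ≡ b)

  IsPrimitiveRoot : ℕ → Carrier → Set ℓ
  IsPrimitiveRoot r ζ = (ζ ^ r ≈ 1#) × (∀ k → 0 < k → k < r → ¬ (ζ ^ k ≈ 1#))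

  eval : List ℕ → Carrier → Carrier
  eval []       z = 0#
  eval (a ∷ as) z = (a · 1#) + z * eval as z

  CSP : {m : ℕ} → (Fin m → Fin m) → Carrier → List ℕ → Set ℓ
  CSP τ ζ f = ∀ (j : ℕ) → (fixCount τ j · 1#) ≈ eval f (ζ ^ j)

  pow : Carrier → ℕ → Carrier
  pow ζ k = ζ ^ k

module Submission where

-- Write n = d·g, so that C_g = ⟨σ^d⟩ with root of unity ω^d, and fix j.
-- • If d ∣ j, say j = j′·d, then σ^j = (σ^d)^j′ and ω^j = (ω^d)^j′, so the
--   required identity is hypothesis (i) at j′.
-- • If d ∤ j, both sides vanish.  The orbit of x has as many points as the
--   least period p of x, every return time of x is a multiple of p, and
--   hypothesis (iii) makes p a multiple of d; hence σ^j has no fixed points.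
--   On the other side z = ω^j satisfies z^n = 1 but z^g ≠ 1 (ω is primitive
--   and n ∤ j·g), while the periodicity (ii) gives z^g·f(z) = f(z); in a ring
--   without zero divisors this forces f(z) = 0.

open import Defs
open import Algebra.Bundles using (CommutativeRing; Semiring)

module Orbits where

  open import Data.Nat using (ℕ; zero; suc; _+_; _*_; _∸_; _<_; _≤_; z≤n; s≤s; NonZero; >-nonZero)
  open import Data.Nat.Properties using (+-assoc; +-identityʳ; m∸n+n≡m; <⇒≤; <-≤-trans; m≤m+n; +-monoʳ-<; m<n⇒0<n∸m; ≮⇒≥; ≤-refl; m*n≢0⇒m≢0; *-cancelˡ-≡; m≤n⇒m<n∨m≡n; <⇒≱; ≤-pred)
  open import Data.Nat.Divisibility using (_∣_; divides; ∣-trans; m%n≡0⇒n∣m)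
  open import Data.Nat.Tactic.RingSolver using (solve-∀)
  open import Data.Nat.DivMod using (_%_; _/_; m≡m%n+[m/n]*n; m%n<n)
  open import Data.Fin using (Fin; toℕ; fromℕ<)
  open import Data.Fin.Properties using (_≟_; toℕ-fromℕ<)
  open import Data.List using (List; length; filter; applyUpTo; allFin)
  open import Data.List.Properties using (length-applyUpTo; filter-≐; filter-none)
  import Data.List.Relation.Unary.All as All
  open import Data.List.Relation.Unary.Any as Any using (Any; any?)
  open import Data.List.Relation.Unary.Unique.Propositional using (Unique)
  open import Data.List.Relation.Unary.Unique.Propositional.Properties using (applyUpTo⁺₁; filter⁺; allFin⁺)
  open import Data.List.Membership.Propositional using (_∈_)
  open import Data.List.Membership.Propositional.Properties using (∈-filter⁺; ∈-filter⁻; ∈-allFin; ∈-applyUpTo⁺; ∈-applyUpTo⁻)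
  open import Data.List.Membership.Propositional.Properties.WithK using (unique∧set⇒bag)
  open import Data.List.Relation.Binary.BagAndSetEquality using (_∼[_]_; set; ∼bag⇒↭)
  open import Data.List.Relation.Binary.Permutation.Propositional.Properties using (↭-length)
  open import Data.Product using (Σ; _×_; _,_; proj₂)
  open import Data.Sum using (_⊎_; inj₁; inj₂)
  open import Data.Empty using (⊥-elim)
  open import Function.Bundles using (mk⇔)
  open import Relation.Binary.PropositionalEquality
  open import Relation.Nullary using (¬_; Dec; yes; no)

  iter-+ : ∀ {A : Set} (f : A → A) a b x → iter f (a + b) x ≡ iter f a (iter f b x)
  iter-+ f zero    b x = refl
  iter-+ f (suc a) b x = cong f (iter-+ f a b x)

  iter-* : ∀ {A : Set} (f : A → A) a b x → iter (iter f a) b x ≡ iter f (b * a) x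
  iter-* f a zero    x = refl
  iter-* f a (suc b) x = trans (cong (iter f a) (iter-* f a b x)) (sym (iter-+ f a (b * a) x))

  iter-periodic : ∀ {A : Set} (f : A → A) p x → iter f p x ≡ x →
    ∀ q r → iter f (r + q * p) x ≡ iter f r x
  iter-periodic f p x fᵖx≡x zero    r = cong (λ t → iter f t x) (+-identityʳ r)
  iter-periodic f p x fᵖx≡x (suc q) r = begin
    iter f (r + (p + q * p)) x ≡⟨ cong (λ t → iter f t x) (sym (+-assoc r p (q * p))) ⟩
    iter f (r + p + q * p) x   ≡⟨ iter-periodic f p x fᵖx≡x q (r + p) ⟩
    iter f (r + p) x           ≡⟨ iter-+ f r p x ⟩
    iter f r (iter f p x)      ≡⟨ cong (iter f r) fᵖx≡x ⟩
    iter f r x                 ∎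
    where open ≡-Reasoning

  record LeastPositive (P : ℕ → Set) : Set where
    field
      value    : ℕ
      positive : 0 < value
      holds    : P value
      least    : ∀ k → 0 < k → k < value → ¬ P k

  search : {P : ℕ → Set} → (∀ k → Dec (P k)) → ∀ N →
    (∀ k → 0 < k → k ≤ N → ¬ P k) ⊎ LeastPositive P
  search P? zero = inj₁ λ k 0<k k≤0 _ → <⇒≱ 0<k k≤0
  search {P} P? (suc N) with search P? N
  ... | inj₂ lp = inj₂ lp
  ... | inj₁ none with P? (suc N)
  ...   | yes PsN = inj₂ record
            { value = suc N ; positive = s≤s z≤n ; holds = PsN
            ; least = λ k 0<k k<sN → none k 0<k (≤-pred k<sN) }
  ...   | no ¬PsN = inj₁ below
    where
    below : ∀ k → 0 < k → k ≤ suc N → ¬ P k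
    below k 0<k k≤sN with m≤n⇒m<n∨m≡n k≤sN
    ... | inj₁ k<sN = none k 0<k (≤-pred k<sN)
    ... | inj₂ refl = ¬PsN

  leastPositive : {P : ℕ → Set} → (∀ k → Dec (P k)) → ∀ N → 0 < N → P N → LeastPositive P
  leastPositive P? N 0<N PN with search P? N
  ... | inj₁ none = ⊥-elim (none N 0<N ≤-refl PN)
  ... | inj₂ lp   = lp

  module Orbit {m : ℕ} (n : ℕ) (0<n : 0 < n) (σ : Fin m → Fin m) (x : Fin m)
               (σⁿx≡x : iter σ n x ≡ x) where

    ReturnsAt : ℕ → Set
    ReturnsAt k = iter σ k x ≡ x

    period : LeastPositive ReturnsAt
    period = leastPositive (λ k → iter σ k x ≟ x) n 0<n σⁿx≡x

    open LeastPositive period renaming (value to p; positive to 0<p; holds to σᵖx≡x)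

    instance
      p≢0 : NonZero p
      p≢0 = >-nonZero 0<p

    p≤n : p ≤ n
    p≤n = ≮⇒≥ (λ n<p → least n 0<n n<p σⁿx≡x)

    iter-mod : ∀ j → iter σ j x ≡ iter σ (j % p) x
    iter-mod j = trans (cong (λ t → iter σ t x) (m≡m%n+[m/n]*n j p))
                       (iter-periodic σ p x σᵖx≡x (j / p) (j % p))

    period-divides : ∀ {j} → ReturnsAt j → p ∣ j
    period-divides {j} σʲx≡x with j % p in j%p≡r
    ... | zero  = m%n≡0⇒n∣m j p j%p≡r
    ... | suc r = ⊥-elim (least (suc r) (s≤s z≤n) (subst (_< p) j%p≡r (m%n<n j p))
                    (trans (subst (λ t → iter σ t x ≡ iter σ j x) j%p≡r (sym (iter-mod j))) σʲx≡x))

    orbitList : List (Fin m)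
    orbitList = applyUpTo (λ k → iter σ k x) p

    orbitList-unique : Unique orbitList
    orbitList-unique = applyUpTo⁺₁ _ p distinct
      where
      -- σ^a x = σ^b x with a < b < p would make p - b + a a smaller period.
      distinct : ∀ {a b} → a < b → b < p → iter σ a x ≢ iter σ b x
      distinct {a} {b} a<b b<p σᵃx≡σᵇx = least (p ∸ b + a) 0<p∸b+a smaller (begin
          iter σ (p ∸ b + a) x        ≡⟨ iter-+ σ (p ∸ b) a x ⟩
          iter σ (p ∸ b) (iter σ a x) ≡⟨ cong (iter σ (p ∸ b)) σᵃx≡σᵇx ⟩
          iter σ (p ∸ b) (iter σ b x) ≡⟨ iter-+ σ (p ∸ b) b x ⟨
          iter σ (p ∸ b + b) x        ≡⟨ cong (λ t → iter σ t x) (m∸n+n≡m (<⇒≤ b<p)) ⟩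
          iter σ p x                  ≡⟨ σᵖx≡x ⟩
          x                           ∎)
        where
        open ≡-Reasoning
        0<p∸b+a : 0 < p ∸ b + a
        0<p∸b+a = <-≤-trans (m<n⇒0<n∸m b<p) (m≤m+n (p ∸ b) a)
        smaller : p ∸ b + a < p
        smaller = subst (p ∸ b + a <_) (m∸n+n≡m (<⇒≤ b<p)) (+-monoʳ-< (p ∸ b) a<b)

    inOrbit? : (y : Fin m) → Dec (Any (λ (k : Fin n) → iter σ (toℕ k) x ≡ y) (allFin n))
    inOrbit? y = any? (λ (k : Fin n) → iter σ (toℕ k) x ≟ y) (allFin n)

    orbitFilter : List (Fin m)
    orbitFilter = filter inOrbit? (allFin m)

    -- Every σ^k x with k < n is some σ^i x with i < p, and conversely as p ≤ n.
    orbitFilter⇔orbitList : orbitFilter ∼[ set ] orbitList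
    orbitFilter⇔orbitList = mk⇔ toList fromList
      where
      toList : ∀ {y} → y ∈ orbitFilter → y ∈ orbitList
      toList y∈ with Any.satisfied (proj₂ (∈-filter⁻ inOrbit? {xs = allFin m} y∈))
      ... | k , σᵏx≡y = subst (_∈ orbitList) (trans (sym (iter-mod (toℕ k))) σᵏx≡y)
                          (∈-applyUpTo⁺ (λ t → iter σ t x) (m%n<n (toℕ k) p))
      fromList : ∀ {y} → y ∈ orbitList → y ∈ orbitFilter
      fromList y∈ with ∈-applyUpTo⁻ (λ t → iter σ t x) y∈
      ... | k , k<p , refl = ∈-filter⁺ inOrbit? (∈-allFin _)
              (Any.map (λ { refl → cong (λ t → iter σ t x) (toℕ-fromℕ< k<n) }) (∈-allFin (fromℕ< k<n)))
        where
        k<n : k < n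
        k<n = <-≤-trans k<p p≤n

    -- Two duplicate-free lists with the same members have the same length.
    orbitSize≡period : orbitSize n σ x ≡ p
    orbitSize≡period = begin
      length orbitFilter ≡⟨ ↭-length (∼bag⇒↭ (unique∧set⇒bag orbitFilter-unique orbitList-unique orbitFilter⇔orbitList)) ⟩
      length orbitList   ≡⟨ length-applyUpTo _ p ⟩
      p                  ∎
      where
      open ≡-Reasoning
      orbitFilter-unique : Unique orbitFilter
      orbitFilter-unique = filter⁺ inOrbit? (allFin⁺ m)

    cofactor-divides-return-times : ∀ {D d g j} → D * orbitSize n σ x ≡ n → n ≡ d * g → D ∣ g →
      ReturnsAt j → d ∣ j
    cofactor-divides-return-times {D} {d} {g} D·s≡n n≡dg (divides e g≡eD) σʲx≡x =
      ∣-trans (divides e p≡ed) (period-divides σʲx≡x)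
      where
      instance
        D≢0 : NonZero D
        D≢0 = m*n≢0⇒m≢0 D {{>-nonZero (subst (0 <_) (sym D·s≡n) 0<n)}}
      p≡ed : p ≡ e * d
      p≡ed = *-cancelˡ-≡ p (e * d) D (begin
        D * p               ≡⟨ cong (D *_) orbitSize≡period ⟨
        D * orbitSize n σ x ≡⟨ trans D·s≡n n≡dg ⟩
        d * g               ≡⟨ cong (d *_) g≡eD ⟩
        d * (e * D)         ≡⟨ rearrange d e D ⟩
        D * (e * d)         ∎)
        where
        open ≡-Reasoning
        rearrange : ∀ d e D → d * (e * D) ≡ D * (e * d)
        rearrange = solve-∀

  fixCount-iter : ∀ {m} (σ : Fin m → Fin m) d j → fixCount (iter σ d) j ≡ fixCount σ (j * d)
  fixCount-iter {m} σ d j = cong length (filter-≐ (λ y → iter (iter σ d) j y ≟ y) (λ y → iter σ (j * d) y ≟ y)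
    ((λ {y} fixed → trans (sym (iter-* σ d j y)) fixed) , (λ {y} fixed → trans (iter-* σ d j y) fixed))
    (allFin m))

  fixCount-none : ∀ {m} (σ : Fin m → Fin m) j → (∀ x → iter σ j x ≢ x) → fixCount σ j ≡ 0
  fixCount-none {m} σ j unfixed =
    cong length (filter-none (λ y → iter σ j y ≟ y) {xs = allFin m} (All.tabulate (λ {y} _ → unfixed y)))

  fixCount-off-multiples : ∀ {m n d g} → 0 < n → (σ : Fin m → Fin m) → IsCyclicAction m n σ →
    n ≡ d * g → (∀ x → Σ ℕ λ D → (D * orbitSize n σ x ≡ n) × (D ∣ g)) →
    ∀ j → ¬ d ∣ j → fixCount σ j ≡ 0
  fixCount-off-multiples {n = n} 0<n σ σⁿ≡id n≡dg orbits j d∤j = fixCount-none σ j unfixed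
    where
    unfixed : ∀ x → iter σ j x ≢ x
    unfixed x σʲx≡x with orbits x
    ... | D , D·s≡n , D∣g =
      d∤j (Orbit.cofactor-divides-return-times n 0<n σ x (σⁿ≡id x) D·s≡n n≡dg D∣g σʲx≡x)

module Polynomials where

  open import Data.Nat using (ℕ; zero; suc; _+_; _∸_; _≤_; _≤?_; z≤n; s≤s)
  open import Data.Nat.Properties using (+-identityʳ)
  open import Data.Integer as ℤ using (ℤ; +_; -[1+_])
  import Data.Integer.Properties as ℤ
  open import Data.Integer.Tactic.RingSolver using (solve-∀)
  open import Data.List using (List; []; _∷_; replicate; _++_; map)
  open import Data.List.Properties using (map-++; map-replicate)
  open import Data.Product using (Σ; _,_)
  open import Data.Empty using (⊥-elim)
  open import Relation.Binary.PropositionalEquality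
  open import Relation.Nullary using (¬_; yes; no)

  _⊕_ : List ℕ → List ℕ → List ℕ
  []       ⊕ l        = l
  (a ∷ as) ⊕ []       = a ∷ as
  (a ∷ as) ⊕ (b ∷ bs) = a + b ∷ (as ⊕ bs)

  shift : ℕ → List ℕ → List ℕ
  shift s l = replicate s 0 ++ l

  SameCoeffs : List ℕ → List ℕ → Set
  SameCoeffs l₁ l₂ = ∀ k → coeff 0 l₁ k ≡ coeff 0 l₂ k

  coeff-⊕ : ∀ l₁ l₂ k → coeff 0 (l₁ ⊕ l₂) k ≡ coeff 0 l₁ k + coeff 0 l₂ k
  coeff-⊕ []       l        k       = refl
  coeff-⊕ (a ∷ as) []       zero    = sym (+-identityʳ a)
  coeff-⊕ (a ∷ as) []       (suc k) = sym (+-identityʳ _)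
  coeff-⊕ (a ∷ as) (b ∷ bs) zero    = refl
  coeff-⊕ (a ∷ as) (b ∷ bs) (suc k) = coeff-⊕ as bs k

  coeff-map : ∀ {A B : Set} (φ : A → B) z L k → coeff (φ z) (map φ L) k ≡ φ (coeff z L k)
  coeff-map φ z []      k       = refl
  coeff-map φ z (a ∷ L) zero    = refl
  coeff-map φ z (a ∷ L) (suc k) = coeff-map φ z L k

  shiftCoeff≡coeff : ∀ s h k → shiftCoeff s h k ≡ coeff (+ 0) (replicate s (+ 0) ++ h) k
  shiftCoeff≡coeff s h k with s ≤? k
  ... | yes s≤k = sym (padded-above s k s≤k)
    where
    padded-above : ∀ s k → s ≤ k → coeff (+ 0) (replicate s (+ 0) ++ h) k ≡ coeff (+ 0) h (k ∸ s)
    padded-above zero    k       _         = refl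
    padded-above (suc s) (suc k) (s≤s s≤k) = padded-above s k s≤k
  ... | no s≰k = sym (padded-below s k s≰k)
    where
    padded-below : ∀ s k → ¬ s ≤ k → coeff (+ 0) (replicate s (+ 0) ++ h) k ≡ + 0
    padded-below zero    k       s≰k = ⊥-elim (s≰k z≤n)
    padded-below (suc s) zero    _   = refl
    padded-below (suc s) (suc k) s≰k = padded-below s k (λ s≤k → s≰k (s≤s s≤k))

  pos neg : ℤ → ℕ
  pos (+ a)    = a
  pos -[1+ a ] = 0
  neg (+ a)    = 0
  neg -[1+ a ] = suc a

  pos-neg : ∀ z → z ≡ + pos z ℤ.- + neg z
  pos-neg (+ a)    = sym (ℤ.+-identityʳ (+ a))
  pos-neg -[1+ a ] = refl

  coeff-split : ∀ h k → coeff (+ 0) h k ≡ + coeff 0 (map pos h) k ℤ.- + coeff 0 (map neg h) k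
  coeff-split h k = trans (pos-neg (coeff (+ 0) h k))
    (sym (cong₂ (λ a b → + a ℤ.- + b) (coeff-map pos (+ 0) h k) (coeff-map neg (+ 0) h k)))

  shiftCoeff-split : ∀ s h k →
    shiftCoeff s h k ≡ + coeff 0 (shift s (map pos h)) k ℤ.- + coeff 0 (shift s (map neg h)) k
  shiftCoeff-split s h k = begin
    shiftCoeff s h k                               ≡⟨ shiftCoeff≡coeff s h k ⟩
    coeff (+ 0) (replicate s (+ 0) ++ h) k         ≡⟨ coeff-split (replicate s (+ 0) ++ h) k ⟩
    + coeff 0 (map pos (replicate s (+ 0) ++ h)) k ℤ.- + coeff 0 (map neg (replicate s (+ 0) ++ h)) k
      ≡⟨ cong₂ (λ P N → + coeff 0 P k ℤ.- + coeff 0 N k) (map-shift pos) (map-shift neg) ⟩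
    + coeff 0 (shift s (map pos h)) k ℤ.- + coeff 0 (shift s (map neg h)) k ∎
    where
    open ≡-Reasoning
    map-shift : ∀ (φ : ℤ → ℕ) → map φ (replicate s (+ 0) ++ h) ≡ replicate s (φ (+ 0)) ++ map φ h
    map-shift φ = trans (map-++ φ (replicate s (+ 0)) h) (cong (_++ map φ h) (map-replicate φ s (+ 0)))

  toℤPoly≡map : ∀ f → toℤPoly f ≡ map +_ f
  toℤPoly≡map []      = refl
  toℤPoly≡map (a ∷ f) = cong (+ a ∷_) (toℤPoly≡map f)

  coeff-toℤ : ∀ f k → coeff (+ 0) (toℤPoly f) k ≡ + coeff 0 f k
  coeff-toℤ f k = trans (cong (λ L → coeff (+ 0) L k) (toℤPoly≡map f)) (coeff-map +_ 0 f k)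

  shiftCoeff-toℤ : ∀ s f k → shiftCoeff s (toℤPoly f) k ≡ + coeff 0 (shift s f) k
  shiftCoeff-toℤ s f k = begin
    shiftCoeff s (toℤPoly f) k                     ≡⟨ shiftCoeff≡coeff s (toℤPoly f) k ⟩
    coeff (+ 0) (replicate s (+ 0) ++ toℤPoly f) k ≡⟨ cong (λ L → coeff (+ 0) L k) padded≡map ⟩
    coeff (+ 0) (map +_ (shift s f)) k             ≡⟨ coeff-map +_ 0 (shift s f) k ⟩
    + coeff 0 (shift s f) k                        ∎
    where
    open ≡-Reasoning
    padded≡map : replicate s (+ 0) ++ toℤPoly f ≡ map +_ (shift s f)
    padded≡map = sym (trans (map-++ +_ (replicate s 0) f)
                            (cong₂ _++_ (map-replicate +_ s 0) (sym (toℤPoly≡map f))))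

  clear-signs : ∀ a b c d e f → + a ℤ.- + b ≡ (+ c ℤ.- + d) ℤ.- (+ e ℤ.- + f) → a + e + d ≡ b + c + f
  clear-signs a b c d e f eq = ℤ.+-injective (begin
      + (a + e + d)                 ≡⟨ embed a e d ⟩
      + a ℤ.+ + e ℤ.+ + d           ≡⟨ ℤ.i-j≡0⇒i≡j _ _ difference≡0 ⟩
      + b ℤ.+ + c ℤ.+ + f           ≡⟨ embed b c f ⟨
      + (b + c + f)                 ∎)
    where
    open ≡-Reasoning
    embed : ∀ x y z → + (x + y + z) ≡ + x ℤ.+ + y ℤ.+ + z
    embed x y z = trans (ℤ.pos-+ (x + y) z) (cong (ℤ._+ + z) (ℤ.pos-+ x y))
    rearrange : ∀ a b c d e f → (a ℤ.+ e ℤ.+ d) ℤ.- (b ℤ.+ c ℤ.+ f) ≡ (a ℤ.- b) ℤ.- ((c ℤ.- d) ℤ.- (e ℤ.- f))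
    rearrange = solve-∀
    difference≡0 : (+ a ℤ.+ + e ℤ.+ + d) ℤ.- (+ b ℤ.+ + c ℤ.+ + f) ≡ + 0
    difference≡0 = begin
      _ ≡⟨ rearrange (+ a) (+ b) (+ c) (+ d) (+ e) (+ f) ⟩
      (+ a ℤ.- + b) ℤ.- ((+ c ℤ.- + d) ℤ.- (+ e ℤ.- + f)) ≡⟨ cong (ℤ._- _) eq ⟩
      _                                                    ≡⟨ ℤ.+-inverseʳ ((+ c ℤ.- + d) ℤ.- (+ e ℤ.- + f)) ⟩
      + 0                                                  ∎

  -- Periodicity of f, q^g f ≡ f mod q^n − 1 with ℤ-cofactor h = h⁺ − h⁻,
  -- restated as an identity in ℕ[q]:  q^g f + h⁺ + q^n h⁻ = f + q^n h⁺ + h⁻.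
  period-in-ℕ[q] : ∀ f g n → HasPeriod f g n → Σ (List ℕ) λ h⁺ → Σ (List ℕ) λ h⁻ →
    SameCoeffs ((shift g f ⊕ h⁺) ⊕ shift n h⁻) ((f ⊕ shift n h⁺) ⊕ h⁻)
  period-in-ℕ[q] f g n (h , period) = h⁺ , h⁻ , same
    where
    h⁺ h⁻ : List ℕ
    h⁺ = map pos h
    h⁻ = map neg h
    same : SameCoeffs ((shift g f ⊕ h⁺) ⊕ shift n h⁻) ((f ⊕ shift n h⁺) ⊕ h⁻)
    same k = begin
      coeff 0 ((shift g f ⊕ h⁺) ⊕ shift n h⁻) k ≡⟨ trans (coeff-⊕ (shift g f ⊕ h⁺) _ k) (cong (_+ D) (coeff-⊕ (shift g f) h⁺ k)) ⟩
      A + E + D                                 ≡⟨ clear-signs A B C D E F integer-identity ⟩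
      B + C + F                                 ≡⟨ sym (trans (coeff-⊕ (f ⊕ shift n h⁺) h⁻ k) (cong (_+ F) (coeff-⊕ f (shift n h⁺) k))) ⟩
      coeff 0 ((f ⊕ shift n h⁺) ⊕ h⁻) k         ∎
      where
      open ≡-Reasoning
      A B C D E F : ℕ
      A = coeff 0 (shift g f) k
      B = coeff 0 f k
      C = coeff 0 (shift n h⁺) k
      D = coeff 0 (shift n h⁻) k
      E = coeff 0 h⁺ k
      F = coeff 0 h⁻ k
      integer-identity : + A ℤ.- + B ≡ (+ C ℤ.- + D) ℤ.- (+ E ℤ.- + F)
      integer-identity = begin
        + A ℤ.- + B                                              ≡⟨ cong₂ ℤ._-_ (shiftCoeff-toℤ g f k) (coeff-toℤ f k) ⟨
        shiftCoeff g (toℤPoly f) k ℤ.- coeff (+ 0) (toℤPoly f) k ≡⟨ period k ⟩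
        shiftCoeff n h k ℤ.- coeff (+ 0) h k                     ≡⟨ cong₂ ℤ._-_ (shiftCoeff-split n h k) (coeff-split h k) ⟩
        (+ C ℤ.- + D) ℤ.- (+ E ℤ.- + F)                          ∎

module Evaluation {c ℓ} (R : CommutativeRing c ℓ) where

  open import Data.Nat as ℕ using (zero; suc; _<_; z≤n; s≤s; NonZero)
  import Data.Nat.Properties as ℕ
  open import Data.Fin using (Fin)
  open import Data.Nat.Divisibility using (_∣_; m%n≡0⇒n∣m; *-cancelʳ-∣)
  open import Data.Nat.DivMod using (_%_; _/_; m≡m%n+[m/n]*n; m%n<n)
  open import Data.List using ([]; _∷_)
  open import Data.Product using (_,_)
  open import Data.Sum using (_⊎_; inj₁; inj₂)
  open import Data.Empty using (⊥-elim)
  import Relation.Binary.PropositionalEquality as ≡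
  import Level
  open import Relation.Nullary using (¬_)
  open Polynomials
  open Orbits using (fixCount-iter)

  open CommutativeRing R
  open import Algebra.Definitions.RawSemiring (Semiring.rawSemiring semiring) using (_^_) renaming (_×_ to _·_) public
  open import Algebra.Properties.Semiring.Exp semiring using (^-homo-*; ^-assocʳ)
  open import Algebra.Properties.Monoid.Mult +-monoid using (×-homo-+)
  open import Algebra.Properties.CommutativeSemigroup +-commutativeSemigroup using () renaming (interchange to +-interchange)
  open import Algebra.Properties.Group +-group using (∙-cancelʳ; x∙y⁻¹≈ε⇒x≈y)
  open import Algebra.Properties.Ring ring using (-1*x≈-x)
  open import Relation.Binary.Reasoning.Setoid setoid

  eval-cong : ∀ f {z z′} → z ≈ z′ → eval R f z ≈ eval R f z′
  eval-cong []      z≈z′ = refl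
  eval-cong (a ∷ f) z≈z′ = +-congˡ (*-cong z≈z′ (eval-cong f z≈z′))

  eval-⊕ : ∀ l₁ l₂ z → eval R (l₁ ⊕ l₂) z ≈ eval R l₁ z + eval R l₂ z
  eval-⊕ []       l        z = sym (+-identityˡ _)
  eval-⊕ (a ∷ as) []       z = sym (+-identityʳ _)
  eval-⊕ (a ∷ as) (b ∷ bs) z = begin
    (a ℕ.+ b) · 1# + z * eval R (as ⊕ bs) z                    ≈⟨ +-cong (×-homo-+ 1# a b) (*-congˡ (eval-⊕ as bs z)) ⟩
    (a · 1# + b · 1#) + z * (eval R as z + eval R bs z)        ≈⟨ +-congˡ (distribˡ z _ _) ⟩
    (a · 1# + b · 1#) + (z * eval R as z + z * eval R bs z)    ≈⟨ +-interchange _ _ _ _ ⟩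
    (a · 1# + z * eval R as z) + (b · 1# + z * eval R bs z)    ∎

  eval-shift : ∀ s l z → eval R (shift s l) z ≈ z ^ s * eval R l z
  eval-shift zero    l z = sym (*-identityˡ _)
  eval-shift (suc s) l z = begin
    0# + z * eval R (shift s l) z ≈⟨ +-identityˡ _ ⟩
    z * eval R (shift s l) z      ≈⟨ *-congˡ (eval-shift s l z) ⟩
    z * (z ^ s * eval R l z)      ≈⟨ sym (*-assoc _ _ _) ⟩
    z * z ^ s * eval R l z        ∎

  eval-zero : ∀ l z → (∀ k → coeff 0 l k ≡.≡ 0) → eval R l z ≈ 0#
  eval-zero []      z zeros = refl
  eval-zero (a ∷ l) z zeros = begin
    a · 1# + z * eval R l z ≈⟨ +-cong (reflexive (≡.cong (_· 1#) (zeros 0))) (*-congˡ (eval-zero l z (λ k → zeros (suc k)))) ⟩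
    0# + z * 0#             ≈⟨ trans (+-identityˡ _) (zeroʳ z) ⟩
    0#                      ∎

  -- Evaluation only depends on coefficients (trailing zeros are harmless).
  eval-sameCoeffs : ∀ l₁ l₂ z → SameCoeffs l₁ l₂ → eval R l₁ z ≈ eval R l₂ z
  eval-sameCoeffs []       l₂       z same = sym (eval-zero l₂ z (λ k → ≡.sym (same k)))
  eval-sameCoeffs (a ∷ l₁) []       z same = eval-zero (a ∷ l₁) z same
  eval-sameCoeffs (a ∷ l₁) (b ∷ l₂) z same =
    +-cong (reflexive (≡.cong (_· 1#) (same 0))) (*-congˡ (eval-sameCoeffs l₁ l₂ z (λ k → same (suc k))))

  eval-periodic : ∀ f g n z → HasPeriod f g n → z ^ n ≈ 1# → z ^ g * eval R f z ≈ eval R f z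
  eval-periodic f g n z period zⁿ≈1 with period-in-ℕ[q] f g n period
  ... | h⁺ , h⁻ , same = ∙-cancelʳ P _ _ (∙-cancelʳ N _ _ (begin
      (z ^ g * F + P) + N          ≈⟨ +-congˡ (absorb N) ⟨
      (z ^ g * F + P) + z ^ n * N  ≈⟨ +-cong (+-congʳ (eval-shift g f z)) (eval-shift n h⁻ z) ⟨
      (eval R (shift g f) z + P) + eval R (shift n h⁻) z
                                   ≈⟨ trans (eval-⊕ (shift g f ⊕ h⁺) (shift n h⁻) z) (+-congʳ (eval-⊕ (shift g f) h⁺ z)) ⟨
      eval R ((shift g f ⊕ h⁺) ⊕ shift n h⁻) z
                                   ≈⟨ eval-sameCoeffs ((shift g f ⊕ h⁺) ⊕ shift n h⁻) ((f ⊕ shift n h⁺) ⊕ h⁻) z same ⟩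
      eval R ((f ⊕ shift n h⁺) ⊕ h⁻) z
                                   ≈⟨ trans (eval-⊕ (f ⊕ shift n h⁺) h⁻ z) (+-congʳ (eval-⊕ f (shift n h⁺) z)) ⟩
      (F + eval R (shift n h⁺) z) + N
                                   ≈⟨ +-congʳ (+-congˡ (trans (eval-shift n h⁺ z) (absorb P))) ⟩
      (F + P) + N                  ∎))
    where
    F P N : Carrier
    F = eval R f z
    P = eval R h⁺ z
    N = eval R h⁻ z
    absorb : ∀ x → z ^ n * x ≈ x
    absorb x = trans (*-congʳ zⁿ≈1) (*-identityˡ x)

  -- The part of IsChar0Domain that the argument needs.
  NoZeroDivisors : Set (c Level.⊔ ℓ)
  NoZeroDivisors = ∀ x y → x * y ≈ 0# → x ≈ 0# ⊎ y ≈ 0#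

  fixed-by-nonunit-is-zero : NoZeroDivisors → ∀ y x → y * x ≈ x → ¬ (y ≈ 1#) → x ≈ 0#
  fixed-by-nonunit-is-zero noZeroDivisors y x yx≈x y≉1 with noZeroDivisors (y - 1#) x [y-1]x≈0
    where
    [y-1]x≈0 : (y - 1#) * x ≈ 0#
    [y-1]x≈0 = begin
      (y - 1#) * x       ≈⟨ distribʳ x y (- 1#) ⟩
      y * x + - 1# * x   ≈⟨ +-cong yx≈x (-1*x≈-x x) ⟩
      x - x              ≈⟨ -‿inverseʳ x ⟩
      0#                 ∎
  ... | inj₁ y-1≈0 = ⊥-elim (y≉1 (x∙y⁻¹≈ε⇒x≈y y 1# y-1≈0))
  ... | inj₂ x≈0   = x≈0

  pow-multiple : ∀ {ω n} → ω ^ n ≈ 1# → ∀ q → ω ^ (q ℕ.* n) ≈ 1#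
  pow-multiple         ωⁿ≈1 zero    = refl
  pow-multiple {ω} {n} ωⁿ≈1 (suc q) = begin
    ω ^ (n ℕ.+ q ℕ.* n)     ≈⟨ ^-homo-* ω n (q ℕ.* n) ⟩
    ω ^ n * ω ^ (q ℕ.* n)   ≈⟨ *-cong ωⁿ≈1 (pow-multiple ωⁿ≈1 q) ⟩
    1# * 1#                 ≈⟨ *-identityˡ 1# ⟩
    1#                      ∎

  pow-mod : ∀ {ω n} .{{_ : NonZero n}} → ω ^ n ≈ 1# → ∀ t → ω ^ t ≈ ω ^ (t % n)
  pow-mod {ω} {n} ωⁿ≈1 t = begin
    ω ^ t                              ≡⟨ ≡.cong (ω ^_) (m≡m%n+[m/n]*n t n) ⟩
    ω ^ (t % n ℕ.+ t / n ℕ.* n)        ≈⟨ ^-homo-* ω (t % n) (t / n ℕ.* n) ⟩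
    ω ^ (t % n) * ω ^ (t / n ℕ.* n)    ≈⟨ *-congˡ (pow-multiple ωⁿ≈1 (t / n)) ⟩
    ω ^ (t % n) * 1#                   ≈⟨ *-identityʳ _ ⟩
    ω ^ (t % n)                        ∎

  primitive-order-divides : ∀ {ω n} .{{_ : NonZero n}} → IsPrimitiveRoot R n ω →
    ∀ t → ω ^ t ≈ 1# → n ∣ t
  primitive-order-divides {ω} {n} (ωⁿ≈1 , no-smaller-order) t ωᵗ≈1 with t % n in t%n≡r
  ... | zero  = m%n≡0⇒n∣m t n t%n≡r
  ... | suc r = ⊥-elim (no-smaller-order (suc r) (s≤s z≤n) (≡.subst (_< n) t%n≡r (m%n<n t n))
                  (trans (sym (≡.subst (λ u → ω ^ t ≈ ω ^ u) t%n≡r (pow-mod ωⁿ≈1 t))) ωᵗ≈1))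

  eval-vanishes : NoZeroDivisors → ∀ {ω n d g} .{{_ : NonZero n}} .{{_ : NonZero g}} → IsPrimitiveRoot R n ω →
    n ≡.≡ d ℕ.* g → ∀ f → HasPeriod f g n → ∀ j → ¬ d ∣ j → eval R f (ω ^ j) ≈ 0#
  eval-vanishes noZeroDivisors {ω} {n} {d} {g} prim@(ωⁿ≈1 , _) n≡dg f period j d∤j =
    fixed-by-nonunit-is-zero noZeroDivisors ((ω ^ j) ^ g) (eval R f (ω ^ j))
      (eval-periodic f g n (ω ^ j) period zⁿ≈1) zᵍ≉1
    where
    zⁿ≈1 : (ω ^ j) ^ n ≈ 1#
    zⁿ≈1 = trans (^-assocʳ ω j n) (pow-multiple ωⁿ≈1 j)
    zᵍ≉1 : ¬ ((ω ^ j) ^ g ≈ 1#)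
    zᵍ≉1 zᵍ≈1 = d∤j (*-cancelʳ-∣ g (≡.subst (_∣ j ℕ.* g) n≡dg
                  (primitive-order-divides prim (j ℕ.* g) (trans (sym (^-assocʳ ω j g)) zᵍ≈1))))

  csp-at-multiples : ∀ {m} (σ : Fin m → Fin m) d ω f → CSP R (iter σ d) (ω ^ d) f →
    ∀ j′ → (fixCount σ (j′ ℕ.* d) · 1#) ≈ eval R f (ω ^ (j′ ℕ.* d))
  csp-at-multiples σ d ω f csp j′ = begin
    fixCount σ (j′ ℕ.* d) · 1#     ≡⟨ ≡.cong (_· 1#) (fixCount-iter σ d j′) ⟨
    fixCount (iter σ d) j′ · 1#    ≈⟨ csp j′ ⟩
    eval R f ((ω ^ d) ^ j′)        ≈⟨ eval-cong f (^-assocʳ ω d j′) ⟩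
    eval R f (ω ^ (d ℕ.* j′))      ≡⟨ ≡.cong (λ t → eval R f (ω ^ t)) (ℕ.*-comm d j′) ⟩
    eval R f (ω ^ (j′ ℕ.* d))      ∎

open import Data.Nat using (ℕ; _*_; _<_; NonZero; >-nonZero)
open import Data.Nat.Properties using (m*n≢0⇒n≢0)
open import Data.Nat.Divisibility using (_∣_; divides; _∣?_)
open import Data.Fin using (Fin)
open import Data.List using (List)
open import Data.Product using (Σ; _×_; _,_)
open import Relation.Binary.PropositionalEquality as ≡ using (_≡_)
open import Relation.Nullary using (yes; no)
open Orbits using (fixCount-off-multiples)

lemma3p3 : ∀ {c ℓ} (R : CommutativeRing c ℓ) → IsChar0Domain R →
    (m n g : ℕ) → 0 < n →
    (σ : Fin m → Fin m) → IsCyclicAction m n σ →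
    (g∣n : g ∣ n) →
    (f : List ℕ) →
    (ω : CommutativeRing.Carrier R) → IsPrimitiveRoot R n ω →
    CSP R (iter σ (_∣_.quotient g∣n)) (pow R ω (_∣_.quotient g∣n)) f →
    HasPeriod f g n →
    (∀ (x : Fin m) → Σ ℕ λ d → (d * orbitSize n σ x ≡ n) × (d ∣ g)) →
    CSP R σ ω f
lemma3p3 R (_ , noZeroDivisors , _) m n g 0<n σ σⁿ≡id (divides d n≡dg) f ω ω-primitive csp period orbits j
  with d ∣? j
... | yes (divides j′ ≡.refl) = csp-at-multiples σ d ω f csp j′
  where open Evaluation R
... | no d∤j = begin
    fixCount σ j · 1# ≡⟨ ≡.cong (_· 1#) (fixCount-off-multiples 0<n σ σⁿ≡id n≡dg orbits j d∤j) ⟩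
    0#                ≈⟨ eval-vanishes noZeroDivisors ω-primitive n≡dg f period j d∤j ⟨
    eval R f (ω ^ j)  ∎
  where
  open Evaluation R
  open CommutativeRing R using (0#; 1#; setoid)
  open import Relation.Binary.Reasoning.Setoid setoid
  instance
    n≢0 : NonZero n
    n≢0 = >-nonZero 0<n
    g≢0 : NonZero g
    g≢0 = m*n≢0⇒n≢0 d {{≡.subst NonZero n≡dg n≢0}}
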